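{- Suppose $0<1/n\ll\epsilon\ll\eta\ll1/2-\alpha$ and $-\epsilon\le\alpha<1/2$. Let $G$ be a graph on $n$ vertices with $\delta(G)=(1/2+\alpha)n$ which is not $2\eta$-extremal, and let $H$ be an $\epsilon n$-factor of $G$. Then $G-H$ (the graph on $V(G)$ with edge set $E(G)\setminus E(H)$) is not $\eta$-extremal.
   Context: Hierarchy convention: "holds whenever $0<1/n\ll a\ll b\ll\dots$" means there are non-decreasing functions such that it holds whenever each parameter is at most the corresponding function of the parameter(s) to its right. An $r$-factor is an $r$-regular spanning subgraph. $x_+:=\max\{x,0\}$. Definition: Let $\eta>0$ and let $G$ be a graph on $n$ vertices, and define $\alpha$ by $\delta(G)=(1/2+\alpha)n$, where $-1/2\le\alpha\le1/2$. $G$ is $\eta$-extremal if there exist disjoint $A,B\subset V(G)$ with (E1) $|A|=(1/2-\sqrt{\alpha_+/2}\pm\eta)n$; (E2) $|B|=(1/2+\sqrt{\alpha_+/2}\pm\eta)n$; (E3) $e(A,B)>(1-\eta)|A||B|$; (E4) $e(B)<(\alpha_++\sqrt{\alpha_+/2}+\eta)n|B|/2$, where $a=x\pm\epsilon$ means $x-\epsilon\le a\le x+\epsilon$, $e(A,B)$ counts edges between $A$ and $B$ and $e(B)$ counts edges inside $B$.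
   Formalization: The parameter η ranges over the rationals, and the functions of the hierarchy convention are taken as maps from ℚ to ℚ. -}

module Defs where

open import Data.Bool using (Bool; true; false; _∧_; not; if_then_else_)
open import Data.Nat as ℕ using (ℕ; zero; suc; NonZero; _<ᵇ_)
open import Data.Fin using (Fin; zero; suc; toℕ)
open import Data.Fin.Subset using (Subset; _∈_; ∣_∣)
open import Data.Vec using (lookup)
open import Data.Integer using (+_)
open import Data.Rational using (ℚ; _/_; _+_; _-_; _*_; _⊔_; _≤_; _<_; 0ℚ; 1ℚ; ½)
open import Data.Product using (Σ; _×_)
open import Data.Sum using (_⊎_)
open import Data.Empty using (⊥)
open import Relation.Nullary using (¬_)
open import Relation.Binary.PropositionalEquality using (_≡_)

record Graph (n : ℕ) : Set where
  field
    adj   : Fin n → Fin n → Bool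
    sym   : ∀ i j → adj i j ≡ adj j i
    irrefl : ∀ i → adj i i ≡ false
open Graph public

count : ∀ {n} → (Fin n → Bool) → ℕ
count {zero}  f = 0
count {suc n} f = (if f zero then 1 else 0) ℕ.+ count (λ i → f (suc i))

sumF : ∀ {n} → (Fin n → ℕ) → ℕ
sumF {zero}  f = 0
sumF {suc n} f = f zero ℕ.+ sumF (λ i → f (suc i))

degree : ∀ {n} → Graph n → Fin n → ℕ
degree G i = count (adj G i)

-- minimum of a function on Fin n (value 0 when n = 0)
minF : ∀ {n} → (Fin n → ℕ) → ℕ
minF {zero}        f = 0
minF {suc zero}    f = f zero
minF {suc (suc n)} f = f zero ℕ.⊓ minF (λ i → f (suc i))

δ : ∀ {n} → Graph n → ℕ
δ G = minF (degree G)

⟦_⟧ : ℕ → ℚ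
⟦ k ⟧ = + k / 1

α : ∀ {n} .{{_ : NonZero n}} → Graph n → ℚ
α {n} G = (+ δ G / n) - ½

_₊ : ℚ → ℚ
x ₊ = x ⊔ 0ℚ

-- Comparisons with c·√t (for c ≥ 0, t ≥ 0), expressed without reals:
--   y ≤ c√t  ⇔  y ≤ 0  ∨  y² ≤ c² t
--   y < c√t  ⇔  y < 0  ∨  y² < c² t
--   c√t ≤ y  ⇔  0 ≤ y  ∧  c² t ≤ y²

_≤[_√_] : ℚ → ℚ → ℚ → Set
y ≤[ c √ t ] = (y ≤ 0ℚ) ⊎ (y * y ≤ c * c * t)

_<[_√_] : ℚ → ℚ → ℚ → Set
y <[ c √ t ] = (y < 0ℚ) ⊎ (y * y < c * c * t)

[_√_]≤_ : ℚ → ℚ → ℚ → Set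
[ c √ t ]≤ y = (0ℚ ≤ y) × (c * c * t ≤ y * y)

-- e(A,B): pairs (a,b) with a ∈ A, b ∈ B, ab ∈ E(G)  (for disjoint A, B
-- this is the number of edges between A and B)
eAB : ∀ {n} → Graph n → Subset n → Subset n → ℕ
eAB G A B = sumF (λ i → count (λ j → lookup A i ∧ lookup B j ∧ adj G i j))

eIn : ∀ {n} → Graph n → Subset n → ℕ
eIn G B = sumF (λ i → count (λ j → lookup B i ∧ lookup B j ∧ (toℕ i <ᵇ toℕ j) ∧ adj G i j))

Disjoint : ∀ {n} → Subset n → Subset n → Set
Disjoint A B = ∀ i → ¬ (i ∈ A × i ∈ B)

Extremal : ∀ {n} .{{_ : NonZero n}} → ℚ → Graph n → Set
Extremal {n} η G =
  Σ (Subset n) λ A → Σ (Subset n) λ B →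
    Disjoint A B ×
    -- (E1) |A| = (1/2 - s ± η) n   where s = √t, t = α₊/2
    ((½ - η) * N - ⟦ ∣ A ∣ ⟧) ≤[ N √ t ] ×
    [ N √ t ]≤ ((½ + η) * N - ⟦ ∣ A ∣ ⟧) ×
    -- (E2) |B| = (1/2 + s ± η) n
    (⟦ ∣ B ∣ ⟧ - (½ + η) * N) ≤[ N √ t ] ×
    [ N √ t ]≤ (⟦ ∣ B ∣ ⟧ - (½ - η) * N) ×
    ((1ℚ - η) * ⟦ ∣ A ∣ ⟧ * ⟦ ∣ B ∣ ⟧ < ⟦ eAB G A B ⟧) ×
    -- (E4) e(B) < (α₊ + s + η) n|B|/2,  i.e.
    --      2e(B) - (α₊ + η) n|B| < n|B| s
    ((⟦ 2 ℕ.* eIn G B ⟧ - (α G ₊ + η) * N * ⟦ ∣ B ∣ ⟧) <[ N * ⟦ ∣ B ∣ ⟧ √ t ])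
  where
  N = ⟦ n ⟧
  t = α G ₊ * ½

IsFactor : ∀ {n} → ℕ → Graph n → Graph n → Set
IsFactor r H G = (∀ i j → adj H i j ≡ true → adj G i j ≡ true) × (∀ i → degree H i ≡ r)

_⊖_ : ∀ {n} → Graph n → Graph n → Graph n
adj (G ⊖ H) i j = adj G i j ∧ not (adj H i j)
sym (G ⊖ H) i j rewrite sym G i j | sym H i j = Relation.Binary.PropositionalEquality.refl
irrefl (G ⊖ H) i rewrite irrefl G i = Relation.Binary.PropositionalEquality.refl

-- Hierarchy functions: non-decreasing, and positive on positive inputs

Admissible : (ℚ → ℚ) → Set
Admissible f = (∀ x y → 0ℚ < x → x ≤ y → f x ≤ f y) × (∀ x → 0ℚ < x → 0ℚ < f x)

-- Removing an εn-factor H changes G very little: the minimum degree drops by at most εn,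
-- so α and α₊ move by at most ε, and the square root √(α₊/2) moves by at most √(ε/2) ≤ η
-- once ε ≤ η²; edges between A and B can only disappear, and B loses at most εn|B| edges.
-- Hence a witness (A, B) for η-extremality of G − H is a witness for 2η-extremality of G.
module Submission where

open import Defs hiding (sym)
open import Data.Bool using (Bool; true; false; _∧_; not; if_then_else_)
open import Data.Fin using (Fin; zero; suc; toℕ)
open import Data.Fin.Subset using (Subset; ∣_∣)
open import Data.Vec using (lookup; _∷_; [])
open import Data.Nat as Nat using (ℕ; NonZero; zero; suc; z≤n; s≤s; _<ᵇ_)
import Data.Nat.Properties as Natₚ
open import Data.Product using (Σ; _×_; _,_)
open import Data.Sum using (_⊎_; inj₁; inj₂)
open import Function using (_∘_)
open import Relation.Nullary using (¬_; yes; no)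
open import Relation.Binary.PropositionalEquality

module Counting where

  open Nat using (_≤_; _+_; _*_)
  open Natₚ using (≤-refl; ≤-trans; ≤-reflexive; +-mono-≤)
  open Natₚ.≤-Reasoning
  open import Algebra.Properties.CommutativeSemigroup Natₚ.+-commutativeSemigroup using (interchange)

  𝟙 : Bool → ℕ
  𝟙 b = if b then 1 else 0

  𝟙-mono : ∀ {b c} → (b ≡ true → c ≡ true) → 𝟙 b ≤ 𝟙 c
  𝟙-mono {false} _ = z≤n
  𝟙-mono {true}  h rewrite h refl = ≤-refl

  𝟙-≤-+ : ∀ {b c d} → (b ≡ true → c ≡ true ⊎ d ≡ true) → 𝟙 b ≤ 𝟙 c + 𝟙 d
  𝟙-≤-+ {false} _ = z≤n
  𝟙-≤-+ {true} {c} h with h refl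
  ... | inj₁ refl = s≤s z≤n
  ... | inj₂ refl = Natₚ.m≤n+m 1 (𝟙 c)

  count-mono : ∀ {n} (f g : Fin n → Bool) → (∀ j → f j ≡ true → g j ≡ true) → count f ≤ count g
  count-mono {zero}  f g _ = z≤n
  count-mono {suc n} f g h = +-mono-≤ (𝟙-mono (h zero)) (count-mono (f ∘ suc) (g ∘ suc) (h ∘ suc))

  count-≤-+ : ∀ {n} (f g h : Fin n → Bool) → (∀ j → f j ≡ true → g j ≡ true ⊎ h j ≡ true) →
              count f ≤ count g + count h
  count-≤-+ {zero}  f g h _     = z≤n
  count-≤-+ {suc n} f g h split = begin
    𝟙 (f zero) + count (f ∘ suc)
      ≤⟨ +-mono-≤ (𝟙-≤-+ (split zero)) (count-≤-+ (f ∘ suc) (g ∘ suc) (h ∘ suc) (split ∘ suc)) ⟩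
    (𝟙 (g zero) + 𝟙 (h zero)) + (count (g ∘ suc) + count (h ∘ suc))
      ≡⟨ interchange (𝟙 (g zero)) (𝟙 (h zero)) _ _ ⟩
    count g + count h ∎

  count-false : ∀ {n} → count {n} (λ _ → false) ≡ 0
  count-false {zero}  = refl
  count-false {suc n} = count-false {n}

  sumF-mono : ∀ {n} (f g : Fin n → ℕ) → (∀ i → f i ≤ g i) → sumF f ≤ sumF g
  sumF-mono {zero}  f g _ = z≤n
  sumF-mono {suc n} f g h = +-mono-≤ (h zero) (sumF-mono (f ∘ suc) (g ∘ suc) (h ∘ suc))

  sumF-+ : ∀ {n} (f g : Fin n → ℕ) → sumF (λ i → f i + g i) ≡ sumF f + sumF g
  sumF-+ {zero}  f g = refl
  sumF-+ {suc n} f g = begin-equality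
    (f zero + g zero) + sumF (λ i → f (suc i) + g (suc i))
      ≡⟨ cong ((f zero + g zero) +_) (sumF-+ (f ∘ suc) (g ∘ suc)) ⟩
    (f zero + g zero) + (sumF (f ∘ suc) + sumF (g ∘ suc))
      ≡⟨ interchange (f zero) (g zero) _ _ ⟩
    sumF f + sumF g ∎

  sumF-const-on-subset : ∀ {n} (B : Subset n) r → sumF (λ i → if lookup B i then r else 0) ≡ r * ∣ B ∣
  sumF-const-on-subset []          r = sym (Natₚ.*-zeroʳ r)
  sumF-const-on-subset (false ∷ B) r = sumF-const-on-subset B r
  sumF-const-on-subset (true ∷ B)  r = trans (cong (r +_) (sumF-const-on-subset B r)) (sym (Natₚ.*-suc r _))

  minF-mono : ∀ {n} (f g : Fin n → ℕ) → (∀ i → f i ≤ g i) → minF f ≤ minF g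
  minF-mono {zero}        f g _ = z≤n
  minF-mono {suc zero}    f g h = h zero
  minF-mono {suc (suc n)} f g h = Natₚ.⊓-mono-≤ (h zero) (minF-mono (f ∘ suc) (g ∘ suc) (h ∘ suc))

  -- Only an inequality: for n = 0 the left side is minF's junk value 0.
  minF-+ʳ : ∀ {n} (f : Fin n → ℕ) r → minF (λ i → f i + r) ≤ minF f + r
  minF-+ʳ {zero}        f r = z≤n
  minF-+ʳ {suc zero}    f r = ≤-refl
  minF-+ʳ {suc (suc n)} f r = begin
    (f zero + r) Nat.⊓ minF (λ i → f (suc i) + r) ≤⟨ Natₚ.⊓-monoʳ-≤ (f zero + r) (minF-+ʳ (f ∘ suc) r) ⟩
    (f zero + r) Nat.⊓ (minF (f ∘ suc) + r)       ≡⟨ Natₚ.+-distribʳ-⊓ r (f zero) _ ⟨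
    minF f + r                                    ∎

module GraphDifference where

  open Nat using (_≤_; _+_; _*_)
  open Natₚ using (≤-trans; ≤-reflexive)
  open Counting

  ∧-elimˡ : ∀ a {b} → a ∧ b ≡ true → a ≡ true
  ∧-elimˡ true _ = refl

  ∧-split-not : ∀ g h → g ≡ true → g ∧ not h ≡ true ⊎ h ≡ true
  ∧-split-not true false _ = inj₁ refl
  ∧-split-not true true  _ = inj₂ refl

  degree-⊖-≤ : ∀ {n} (G H : Graph n) i → degree (G ⊖ H) i ≤ degree G i
  degree-⊖-≤ G H i = count-mono _ _ (λ j → ∧-elimˡ (adj G i j))

  degree-≤-⊖-+ : ∀ {n} (G H : Graph n) i → degree G i ≤ degree (G ⊖ H) i + degree H i
  degree-≤-⊖-+ G H i = count-≤-+ _ _ _ (λ j → ∧-split-not (adj G i j) (adj H i j))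

  δ-⊖-≤ : ∀ {n} (G H : Graph n) → δ (G ⊖ H) ≤ δ G
  δ-⊖-≤ G H = minF-mono _ _ (degree-⊖-≤ G H)

  δ-≤-⊖-+ : ∀ {n} (G H : Graph n) r → (∀ i → degree H i ≡ r) → δ G ≤ δ (G ⊖ H) + r
  δ-≤-⊖-+ G H r regular = ≤-trans
    (minF-mono _ (λ i → degree (G ⊖ H) i + r)
      (λ i → ≤-trans (degree-≤-⊖-+ G H i) (≤-reflexive (cong (degree (G ⊖ H) i +_) (regular i)))))
    (minF-+ʳ (degree (G ⊖ H)) r)

  eAB-⊖-≤ : ∀ {n} (G H : Graph n) A B → eAB (G ⊖ H) A B ≤ eAB G A B
  eAB-⊖-≤ G H A B = sumF-mono _ _ λ i → count-mono _ _ λ j → drop-not (lookup A i) (lookup B j) (adj G i j)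
    where
    drop-not : ∀ a b g {h} → a ∧ b ∧ (g ∧ h) ≡ true → a ∧ b ∧ g ≡ true
    drop-not true true true _ = refl

  eIn-≤-⊖-+ : ∀ {n} (G H : Graph n) B → eIn G B ≤ eIn (G ⊖ H) B + eIn H B
  eIn-≤-⊖-+ G H B = ≤-trans
    (sumF-mono _ _ λ i → count-≤-+ _ _ _ λ j →
      split (lookup B i) (lookup B j) (toℕ i <ᵇ toℕ j) (adj G i j) (adj H i j))
    (≤-reflexive (sumF-+ (rowIn (G ⊖ H)) (rowIn H)))
    where
    rowIn : Graph _ → Fin _ → ℕ
    rowIn K i = count (λ j → lookup B i ∧ lookup B j ∧ (toℕ i <ᵇ toℕ j) ∧ adj K i j)
    split : ∀ a b c g h → a ∧ b ∧ c ∧ g ≡ true → a ∧ b ∧ c ∧ (g ∧ not h) ≡ true ⊎ a ∧ b ∧ c ∧ h ≡ true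
    split true true true true false _ = inj₁ refl
    split true true true true true  _ = inj₂ refl

  eIn-≤-regular : ∀ {n} (H : Graph n) B r → (∀ i → degree H i ≡ r) → eIn H B ≤ r * ∣ B ∣
  eIn-≤-regular {n} H B r regular = ≤-trans
    (sumF-mono _ _ λ i → row-≤ (lookup B i) (regular i))
    (≤-reflexive (sumF-const-on-subset B r))
    where
    keep-edge : ∀ b c {h} → b ∧ c ∧ h ≡ true → h ≡ true
    keep-edge true true e = e
    row-≤ : ∀ {i} b → degree H i ≡ r →
            count (λ j → b ∧ lookup B j ∧ (toℕ i <ᵇ toℕ j) ∧ adj H i j) ≤ (if b then r else 0)
    row-≤ false _ = ≤-reflexive (count-false {n})
    row-≤ {i} true refl = count-mono _ _ λ j → keep-edge (lookup B j) (toℕ i <ᵇ toℕ j)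

open import Data.Integer as ℤ using (+_)
import Data.Integer.Properties as ℤₚ
open import Data.Rational
  using (ℚ; _/_; _+_; _-_; _*_; -_; _≤_; _<_; 0ℚ; 1ℚ; ½; NonNegative; positive; nonNegative; nonPositive; toℚᵘ; *≤*)
open import Data.Rational.Properties
open import Data.Rational.Unnormalised as ℚᵘ using (ℚᵘ; mkℚᵘ)
import Data.Rational.Unnormalised.Properties as ℚᵘₚ
open import Data.Rational.Solver using (module +-*-Solver)
open +-*-Solver using (solve; _:=_; _:+_; _:*_; _:-_; con)

private
  ⟦_⟧ᵘ : ℕ → ℚᵘ
  ⟦ k ⟧ᵘ = mkℚᵘ (+ k) 0

  toℚᵘ-⟦⟧ : ∀ k → toℚᵘ ⟦ k ⟧ ℚᵘ.≃ ⟦ k ⟧ᵘ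
  toℚᵘ-⟦⟧ k = toℚᵘ-fromℚᵘ ⟦ k ⟧ᵘ

⟦⟧-+ : ∀ a b → ⟦ a Nat.+ b ⟧ ≡ ⟦ a ⟧ + ⟦ b ⟧
⟦⟧-+ a b = toℚᵘ-injective (ℚᵘₚ.≃-trans (toℚᵘ-⟦⟧ (a Nat.+ b)) (ℚᵘₚ.≃-trans (ℚᵘ.*≡* cross)
  (ℚᵘₚ.≃-sym (ℚᵘₚ.≃-trans (toℚᵘ-homo-+ ⟦ a ⟧ ⟦ b ⟧) (ℚᵘₚ.+-cong (toℚᵘ-⟦⟧ a) (toℚᵘ-⟦⟧ b))))))
  where
  cross : + (a Nat.+ b) ℤ.* + 1 ≡ (+ a ℤ.* + 1 ℤ.+ + b ℤ.* + 1) ℤ.* + 1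
  cross rewrite ℤₚ.pos-+ a b | ℤₚ.*-identityʳ (+ a) | ℤₚ.*-identityʳ (+ b) = refl

⟦⟧-* : ∀ a b → ⟦ a Nat.* b ⟧ ≡ ⟦ a ⟧ * ⟦ b ⟧
⟦⟧-* a b = toℚᵘ-injective (ℚᵘₚ.≃-trans (toℚᵘ-⟦⟧ (a Nat.* b)) (ℚᵘₚ.≃-trans (ℚᵘ.*≡* (cong (ℤ._* + 1) (ℤₚ.pos-* a b)))
  (ℚᵘₚ.≃-sym (ℚᵘₚ.≃-trans (toℚᵘ-homo-* ⟦ a ⟧ ⟦ b ⟧) (ℚᵘₚ.*-cong (toℚᵘ-⟦⟧ a) (toℚᵘ-⟦⟧ b))))))

⟦⟧-mono : ∀ {a b} → a Nat.≤ b → ⟦ a ⟧ ≤ ⟦ b ⟧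
⟦⟧-mono {a} {b} a≤b = toℚᵘ-cancel-≤
  (ℚᵘₚ.≤-respʳ-≃ (ℚᵘₚ.≃-sym (toℚᵘ-⟦⟧ b)) (ℚᵘₚ.≤-respˡ-≃ (ℚᵘₚ.≃-sym (toℚᵘ-⟦⟧ a))
    (ℚᵘ.*≤* (subst₂ ℤ._≤_ (sym (ℤₚ.*-identityʳ (+ a))) (sym (ℤₚ.*-identityʳ (+ b))) (ℤ.+≤+ a≤b)))))

0≤⟦⟧ : ∀ a → 0ℚ ≤ ⟦ a ⟧
0≤⟦⟧ a = ⟦⟧-mono {0} {a} z≤n

0<⟦⟧ : ∀ n .{{_ : NonZero n}} → 0ℚ < ⟦ n ⟧
0<⟦⟧ n = <-≤-trans (positive⁻¹ ⟦ 1 ⟧) (⟦⟧-mono (Nat.>-nonZero⁻¹ n))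

k/n*n≡k : ∀ k n .{{_ : NonZero n}} → (+ k / n) * ⟦ n ⟧ ≡ ⟦ k ⟧
k/n*n≡k k (suc m) = toℚᵘ-injective (ℚᵘₚ.≃-trans (toℚᵘ-homo-* (+ k / suc m) ⟦ suc m ⟧)
  (ℚᵘₚ.≃-trans (ℚᵘₚ.*-cong (toℚᵘ-fromℚᵘ (mkℚᵘ (+ k) m)) (toℚᵘ-⟦⟧ (suc m)))
    (ℚᵘₚ.≃-trans (ℚᵘ.*≡* cross) (ℚᵘₚ.≃-sym (toℚᵘ-⟦⟧ k)))))
  where
  cross : (+ k ℤ.* + suc m) ℤ.* + 1 ≡ + k ℤ.* + (suc m Nat.* 1)
  cross rewrite Natₚ.*-identityʳ (suc m) | ℤₚ.*-identityʳ (+ k ℤ.* + suc m) = refl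

p≤p+q : ∀ p {q} → 0ℚ ≤ q → p ≤ p + q
p≤p+q p 0≤q = ≤-trans (≤-reflexive (sym (+-identityʳ p))) (+-monoʳ-≤ p 0≤q)

0≤* : ∀ {p q} → 0ℚ ≤ p → 0ℚ ≤ q → 0ℚ ≤ p * q
0≤* {p} {q} 0≤p 0≤q = nonNegative⁻¹ (p * q)
  {{nonNeg*nonNeg⇒nonNeg p {{nonNegative 0≤p}} q {{nonNegative 0≤q}}}}

0≤p*p : ∀ p → 0ℚ ≤ p * p
0≤p*p p with ≤-total 0ℚ p
... | inj₁ 0≤p = 0≤* 0≤p 0≤p
... | inj₂ p≤0 = subst (_≤ p * p) (*-zeroʳ p) (*-monoˡ-≤-nonPos p {{nonPositive p≤0}} p≤0)

*-self-mono-≤ : ∀ {p q} → 0ℚ ≤ p → p ≤ q → p * p ≤ q * q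
*-self-mono-≤ {p} {q} 0≤p p≤q = ≤-trans (*-monoˡ-≤-nonNeg p {{nonNegative 0≤p}} p≤q)
  (*-monoʳ-≤-nonNeg q {{nonNegative (≤-trans 0≤p p≤q)}} p≤q)

c*c*-mono : ∀ c {t t'} → t' ≤ t → c * c * t' ≤ c * c * t
c*c*-mono c = *-monoˡ-≤-nonNeg (c * c) {{nonNegative (0≤p*p c)}}

-⁻-mono-≤ : ∀ {p p' q q'} → p ≤ p' → q' ≤ q → p - q ≤ p' - q'
-⁻-mono-≤ p≤p' q'≤q = +-mono-≤ p≤p' (neg-antimono-≤ q'≤q)

≤√-mono : ∀ {y y' c t t'} → y ≤ y' → t' ≤ t → y' ≤[ c √ t' ] → y ≤[ c √ t ]
≤√-mono y≤y' _ (inj₁ y'≤0) = inj₁ (≤-trans y≤y' y'≤0)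
≤√-mono {y} {c = c} y≤y' t'≤t (inj₂ sq) with y ≤? 0ℚ
... | yes y≤0 = inj₁ y≤0
... | no  y≰0 = inj₂ (≤-trans (*-self-mono-≤ (<⇒≤ (≰⇒> y≰0)) y≤y') (≤-trans sq (c*c*-mono c t'≤t)))

<√-mono : ∀ {y y' c t t'} → y ≤ y' → t' ≤ t → y' <[ c √ t' ] → y <[ c √ t ]
<√-mono y≤y' _ (inj₁ y'<0) = inj₁ (≤-<-trans y≤y' y'<0)
<√-mono {y} {c = c} y≤y' t'≤t (inj₂ sq) with y <? 0ℚ
... | yes y<0 = inj₁ y<0
... | no  y≮0 = inj₂ (≤-<-trans (*-self-mono-≤ (≮⇒≥ y≮0) y≤y') (<-≤-trans sq (c*c*-mono c t'≤t)))

-- c√t ≤ c√t' + d, since (c√t' + d)² ≥ c²t' + d².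
√≤-+ : ∀ {z z' d c t t'} → 0ℚ ≤ d → c * c * t ≤ c * c * t' + d * d → z' + d ≤ z →
       [ c √ t' ]≤ z' → [ c √ t ]≤ z
√≤-+ {z} {z'} {d} {c} {t} {t'} 0≤d ct≤ct'+dd z'+d≤z (0≤z' , ct'≤z'z') =
  ≤-trans (p≤p+q 0ℚ 0≤d) (≤-trans (+-mono-≤ 0≤z' ≤-refl) z'+d≤z) ,
  (begin
    c * c * t                               ≤⟨ ct≤ct'+dd ⟩
    c * c * t' + d * d                      ≤⟨ +-monoˡ-≤ (d * d) ct'≤z'z' ⟩
    z' * z' + d * d                         ≤⟨ p≤p+q _ (+-mono-≤ (0≤* 0≤z' 0≤d) (0≤* 0≤z' 0≤d)) ⟩
    (z' * z' + d * d) + (z' * d + z' * d)   ≡⟨ square-+ z' d ⟩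
    (z' + d) * (z' + d)                     ≤⟨ *-self-mono-≤ (≤-trans 0≤z' (p≤p+q z' 0≤d)) z'+d≤z ⟩
    z * z                                   ∎)
  where
  open ≤-Reasoning
  square-+ : ∀ x y → (x * x + y * y) + (x * y + x * y) ≡ (x + y) * (x + y)
  square-+ = solve 2 (λ x y → (x :* x :+ y :* y) :+ (x :* y :+ x :* y) := (x :+ y) :* (x :+ y)) refl

₊-mono : ∀ {p q} → p ≤ q → p ₊ ≤ q ₊
₊-mono = ⊔-monoˡ-≤ 0ℚ

₊-≤-+ : ∀ {p q ε} → 0ℚ ≤ ε → p ≤ q + ε → p ₊ ≤ q ₊ + ε
₊-≤-+ {p} {q} {ε} 0≤ε p≤q+ε =
  ⊔-lub (≤-trans p≤q+ε (+-monoˡ-≤ ε (p≤p⊔q q 0ℚ))) (≤-trans (p≤q⊔p q 0ℚ) (p≤p+q (q ₊) 0≤ε))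

/-monoˡ-≤ : ∀ n .{{_ : NonZero n}} {j k} → j Nat.≤ k → + j / n ≤ + k / n
/-monoˡ-≤ n {j} {k} j≤k = *-cancelʳ-≤-pos ⟦ n ⟧ {{positive (0<⟦⟧ n)}}
  (subst₂ _≤_ (sym (k/n*n≡k j n)) (sym (k/n*n≡k k n)) (⟦⟧-mono j≤k))

α-mono : ∀ {n} .{{_ : NonZero n}} (G G' : Graph n) → δ G' Nat.≤ δ G → α G' ≤ α G
α-mono {n} G G' δ≤ = +-monoˡ-≤ (- ½) (/-monoˡ-≤ n δ≤)

α-≤-+ : ∀ {n} .{{_ : NonZero n}} (G G' : Graph n) r {ε} →
        δ G Nat.≤ δ G' Nat.+ r → ⟦ r ⟧ ≡ ε * ⟦ n ⟧ → α G ≤ α G' + ε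
α-≤-+ {n} G G' r {ε} δ≤ r≡εn = begin
  + δ G / n - ½          ≤⟨ +-monoˡ-≤ (- ½) {+ δ G / n} {+ δ G' / n + ε}
                              (*-cancelʳ-≤-pos N {{positive (0<⟦⟧ n)}} δ≤-in-ℚ) ⟩
  (+ δ G' / n + ε) - ½   ≡⟨ solve 2 (λ q e → (q :+ e) :- con ½ := (q :- con ½) :+ e) refl (+ δ G' / n) ε ⟩
  (+ δ G' / n - ½) + ε   ∎
  where
  open ≤-Reasoning
  N = ⟦ n ⟧
  δ≤-in-ℚ : (+ δ G / n) * N ≤ (+ δ G' / n + ε) * N
  δ≤-in-ℚ = begin
    (+ δ G / n) * N                 ≡⟨ k/n*n≡k (δ G) n ⟩
    ⟦ δ G ⟧                         ≤⟨ ⟦⟧-mono δ≤ ⟩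
    ⟦ δ G' Nat.+ r ⟧                ≡⟨ ⟦⟧-+ (δ G') r ⟩
    ⟦ δ G' ⟧ + ⟦ r ⟧                ≡⟨ cong₂ _+_ (sym (k/n*n≡k (δ G') n)) r≡εn ⟩
    (+ δ G' / n) * N + ε * N        ≡⟨ *-distribʳ-+ N (+ δ G' / n) ε ⟨
    (+ δ G' / n + ε) * N            ∎

record Perturbation {n} .{{_ : NonZero n}} (ε : ℚ) (G G' : Graph n) : Set where
  field
    α-≥   : α G' ≤ α G
    α-≤-+ε : α G ≤ α G' + ε
    eAB-≥ : ∀ A B → eAB G' A B Nat.≤ eAB G A B
    eIn-≤ : ∀ B → ⟦ 2 Nat.* eIn G B ⟧ ≤ ⟦ 2 Nat.* eIn G' B ⟧ + (ε + ε) * ⟦ n ⟧ * ⟦ ∣ B ∣ ⟧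

⊖-factor-perturbation : ∀ {n} .{{_ : NonZero n}} (G H : Graph n) r ε →
                        IsFactor r H G → ⟦ r ⟧ ≡ ε * ⟦ n ⟧ → Perturbation ε G (G ⊖ H)
⊖-factor-perturbation {n} G H r ε (_ , regular) r≡εn = record
  { α-≥    = α-mono G (G ⊖ H) (δ-⊖-≤ G H)
  ; α-≤-+ε = α-≤-+ G (G ⊖ H) r (δ-≤-⊖-+ G H r regular) r≡εn
  ; eAB-≥  = eAB-⊖-≤ G H
  ; eIn-≤  = eIn-bound
  }
  where
  open GraphDifference
  eIn-bound : ∀ B → ⟦ 2 Nat.* eIn G B ⟧ ≤ ⟦ 2 Nat.* eIn (G ⊖ H) B ⟧ + (ε + ε) * ⟦ n ⟧ * ⟦ ∣ B ∣ ⟧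
  eIn-bound B = begin
    ⟦ 2 Nat.* eIn G B ⟧                                  ≤⟨ ⟦⟧-mono (Natₚ.*-monoʳ-≤ 2 in-ℕ) ⟩
    ⟦ 2 Nat.* (eIn (G ⊖ H) B Nat.+ r Nat.* ∣ B ∣) ⟧          ≡⟨ ⟦⟧-* 2 (eIn (G ⊖ H) B Nat.+ r Nat.* ∣ B ∣) ⟩
    ⟦ 2 ⟧ * ⟦ eIn (G ⊖ H) B Nat.+ r Nat.* ∣ B ∣ ⟧          ≡⟨ cong (⟦ 2 ⟧ *_) (⟦⟧-+ (eIn (G ⊖ H) B) _) ⟩
    ⟦ 2 ⟧ * (⟦ eIn (G ⊖ H) B ⟧ + ⟦ r Nat.* ∣ B ∣ ⟧)      ≡⟨ cong (λ x → ⟦ 2 ⟧ * (⟦ eIn (G ⊖ H) B ⟧ + x))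
                                                           (trans (⟦⟧-* r ∣ B ∣) (cong (_* ⟦ ∣ B ∣ ⟧) r≡εn)) ⟩
    ⟦ 2 ⟧ * (⟦ eIn (G ⊖ H) B ⟧ + ε * ⟦ n ⟧ * ⟦ ∣ B ∣ ⟧) ≡⟨ regroup ⟦ eIn (G ⊖ H) B ⟧ ε ⟦ n ⟧ ⟦ ∣ B ∣ ⟧ ⟩
    ⟦ 2 ⟧ * ⟦ eIn (G ⊖ H) B ⟧ + (ε + ε) * ⟦ n ⟧ * ⟦ ∣ B ∣ ⟧  ≡⟨ cong (_+ _) (⟦⟧-* 2 (eIn (G ⊖ H) B)) ⟨
    ⟦ 2 Nat.* eIn (G ⊖ H) B ⟧ + (ε + ε) * ⟦ n ⟧ * ⟦ ∣ B ∣ ⟧    ∎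
    where
    open ≤-Reasoning
    in-ℕ : eIn G B Nat.≤ eIn (G ⊖ H) B Nat.+ r Nat.* ∣ B ∣
    in-ℕ = Natₚ.≤-trans (eIn-≤-⊖-+ G H B) (Natₚ.+-monoʳ-≤ (eIn (G ⊖ H) B) (eIn-≤-regular H B r regular))
    regroup : ∀ e x m b → ⟦ 2 ⟧ * (e + x * m * b) ≡ ⟦ 2 ⟧ * e + (x + x) * m * b
    regroup = solve 4 (λ e x m b → con ⟦ 2 ⟧ :* (e :+ x :* m :* b) := con ⟦ 2 ⟧ :* e :+ (x :+ x) :* m :* b) refl

module PerturbationBounds {n} .{{_ : NonZero n}} {ε η} {G G' : Graph n} (P : Perturbation ε G G')
                         (0≤ε : 0ℚ ≤ ε) (0≤η : 0ℚ ≤ η) (ε≤η² : ε ≤ η * η) (η≤½ : η ≤ ½) where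

  open Perturbation P
  open ≤-Reasoning

  N = ⟦ n ⟧
  η₂ = + 2 / 1 * η
  p = α G ₊
  p' = α G' ₊
  t = p * ½
  t' = p' * ½

  N-nonNeg : NonNegative N
  N-nonNeg = nonNegative (0≤⟦⟧ n)

  0≤ηN : 0ℚ ≤ η * N
  0≤ηN = 0≤* 0≤η (0≤⟦⟧ n)

  η≤η₂ : η ≤ η₂
  η≤η₂ = ≤-trans (p≤p+q η 0≤η) (≤-reflexive (solve 1 (λ x → x :+ x := con (+ 2 / 1) :* x) refl η))

  ε+ε≤η : ε + ε ≤ η
  ε+ε≤η = begin
    ε + ε                ≤⟨ +-mono-≤ ε≤η½ ε≤η½ ⟩
    η * ½ + η * ½        ≡⟨ solve 1 (λ x → x :* con ½ :+ x :* con ½ := x) refl η ⟩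
    η                    ∎
    where
    ε≤η½ : ε ≤ η * ½
    ε≤η½ = ≤-trans ε≤η² (*-monoˡ-≤-nonNeg η {{nonNegative 0≤η}} η≤½)

  t'≤t : t' ≤ t
  t'≤t = *-monoʳ-≤-nonNeg ½ (₊-mono α-≥)

  t≤t'+η² : t ≤ t' + η * η
  t≤t'+η² = begin
    p * ½            ≤⟨ *-monoʳ-≤-nonNeg ½ (₊-≤-+ {α G} {α G'} 0≤ε α-≤-+ε) ⟩
    (p' + ε) * ½     ≡⟨ *-distribʳ-+ ½ p' ε ⟩
    t' + ε * ½       ≤⟨ +-monoʳ-≤ t' (*-monoˡ-≤-nonNeg ε {{nonNegative 0≤ε}} ½≤1) ⟩
    t' + ε * 1ℚ      ≡⟨ cong (λ x → t' + x) (*-identityʳ ε) ⟩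
    t' + ε           ≤⟨ +-monoʳ-≤ t' ε≤η² ⟩
    t' + η * η       ∎
    where
    ½≤1 : ½ ≤ 1ℚ
    ½≤1 = *≤* (ℤ.+≤+ (s≤s z≤n))

  N²t≤N²t'+[ηN]² : N * N * t ≤ N * N * t' + (η * N) * (η * N)
  N²t≤N²t'+[ηN]² = begin
    N * N * t                      ≤⟨ c*c*-mono N t≤t'+η² ⟩
    N * N * (t' + η * η)           ≡⟨ solve 3 (λ m s e → m :* m :* (s :+ e :* e) := m :* m :* s :+ (e :* m) :* (e :* m))
                                        refl N t' η ⟩
    N * N * t' + (η * N) * (η * N) ∎

  E1-lower : ∀ a → ((½ - η) * N - a) ≤[ N √ t' ] → ((½ - η₂) * N - a) ≤[ N √ t ]
  E1-lower a = ≤√-mono {c = N} {t = t} {t' = t'}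
    (+-monoˡ-≤ (- a) {(½ - η₂) * N} {(½ - η) * N}
      (*-monoʳ-≤-nonNeg N {{N-nonNeg}} (+-monoʳ-≤ ½ (neg-antimono-≤ η≤η₂))))
    t'≤t

  E1-upper : ∀ a → [ N √ t' ]≤ ((½ + η) * N - a) → [ N √ t ]≤ ((½ + η₂) * N - a)
  E1-upper a = √≤-+ {c = N} {t = t} {t' = t'} 0≤ηN N²t≤N²t'+[ηN]² (≤-reflexive
    (solve 3 (λ e m x → ((con ½ :+ e) :* m :- x) :+ e :* m := (con ½ :+ con (+ 2 / 1) :* e) :* m :- x)
      refl η N a))

  E2-lower : ∀ b → (b - (½ + η) * N) ≤[ N √ t' ] → (b - (½ + η₂) * N) ≤[ N √ t ]
  E2-lower b = ≤√-mono {c = N} {t = t} {t' = t'}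
    (+-monoʳ-≤ b (neg-antimono-≤ (*-monoʳ-≤-nonNeg N {{N-nonNeg}} (+-monoʳ-≤ ½ η≤η₂))))
    t'≤t

  E2-upper : ∀ b → [ N √ t' ]≤ (b - (½ - η) * N) → [ N √ t ]≤ (b - (½ - η₂) * N)
  E2-upper b = √≤-+ {c = N} {t = t} {t' = t'} 0≤ηN N²t≤N²t'+[ηN]² (≤-reflexive
    (solve 3 (λ e m x → (x :- (con ½ :- e) :* m) :+ e :* m := x :- (con ½ :- con (+ 2 / 1) :* e) :* m)
      refl η N b))

  E3 : ∀ A B → let a = ⟦ ∣ A ∣ ⟧ ; b = ⟦ ∣ B ∣ ⟧ in
       (1ℚ - η) * a * b < ⟦ eAB G' A B ⟧ → (1ℚ - η₂) * a * b < ⟦ eAB G A B ⟧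
  E3 A B e3 = begin-strict
    (1ℚ - η₂) * a * b    ≤⟨ *-monoʳ-≤-nonNeg b {{nonNegative (0≤⟦⟧ ∣ B ∣)}}
                              (*-monoʳ-≤-nonNeg a {{nonNegative (0≤⟦⟧ ∣ A ∣)}} (+-monoʳ-≤ 1ℚ (neg-antimono-≤ η≤η₂))) ⟩
    (1ℚ - η) * a * b     <⟨ e3 ⟩
    ⟦ eAB G' A B ⟧       ≤⟨ ⟦⟧-mono (eAB-≥ A B) ⟩
    ⟦ eAB G A B ⟧        ∎
    where
    a = ⟦ ∣ A ∣ ⟧
    b = ⟦ ∣ B ∣ ⟧

  E4 : ∀ B → let b = ⟦ ∣ B ∣ ⟧ in
       (⟦ 2 Nat.* eIn G' B ⟧ - (p' + η) * N * b) <[ N * b √ t' ] →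
       (⟦ 2 Nat.* eIn G B ⟧ - (p + η₂) * N * b) <[ N * b √ t ]
  E4 B = <√-mono {c = N * b} {t = t} {t' = t'} y≤y' t'≤t
    where
    b = ⟦ ∣ B ∣ ⟧
    e = ⟦ 2 Nat.* eIn G B ⟧
    e' = ⟦ 2 Nat.* eIn G' B ⟧
    scale : ∀ {x y} → x ≤ y → x * N * b ≤ y * N * b
    scale x≤y = *-monoʳ-≤-nonNeg b {{nonNegative (0≤⟦⟧ ∣ B ∣)}} (*-monoʳ-≤-nonNeg N {{N-nonNeg}} x≤y)
    p'+η+2ε≤p+η₂ : p' + η + (ε + ε) ≤ p + η₂
    p'+η+2ε≤p+η₂ = begin
      p' + η + (ε + ε)     ≤⟨ +-mono-≤ (+-monoˡ-≤ η (₊-mono α-≥)) ε+ε≤η ⟩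
      p + η + η            ≡⟨ solve 2 (λ x y → x :+ y :+ y := x :+ con (+ 2 / 1) :* y) refl p η ⟩
      p + η₂               ∎
    y≤y' : e - (p + η₂) * N * b ≤ e' - (p' + η) * N * b
    y≤y' = begin
      e - (p + η₂) * N * b                                 ≤⟨ -⁻-mono-≤ (eIn-≤ B) (scale p'+η+2ε≤p+η₂) ⟩
      (e' + (ε + ε) * N * b) - (p' + η + (ε + ε)) * N * b  ≡⟨ cancel e' p' η (ε + ε) ⟩
      e' - (p' + η) * N * b                                ∎
      where
      cancel : ∀ x q y z → (x + z * N * b) - (q + y + z) * N * b ≡ x - (q + y) * N * b
      cancel x q y z = solve 6 (λ x q y z m c → (x :+ z :* m :* c) :- (q :+ y :+ z) :* m :* c := x :- (q :+ y) :* m :* c)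
                         refl x q y z N b

perturbation-extremal : ∀ {n} .{{_ : NonZero n}} {ε η} (G G' : Graph n) →
  Perturbation ε G G' → 0ℚ ≤ ε → 0ℚ ≤ η → ε ≤ η * η → η ≤ ½ →
  Extremal η G' → Extremal (+ 2 / 1 * η) G
perturbation-extremal G G' P 0≤ε 0≤η ε≤η² η≤½ (A , B , disjoint , e1⁻ , e1⁺ , e2⁻ , e2⁺ , e3 , e4) =
  A , B , disjoint ,
  E1-lower a e1⁻ , E1-upper a e1⁺ , E2-lower b e2⁻ , E2-upper b e2⁺ , E3 A B e3 , E4 B e4
  where
  open PerturbationBounds P 0≤ε 0≤η ε≤η² η≤½
  a = ⟦ ∣ A ∣ ⟧
  b = ⟦ ∣ B ∣ ⟧

const-admissible : ∀ c → 0ℚ < c → Admissible (λ _ → c)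
const-admissible c 0<c = (λ _ _ _ _ → ≤-refl) , (λ _ _ → 0<c)

square-admissible : Admissible (λ x → x * x)
square-admissible =
  (λ x y 0<x x≤y → *-self-mono-≤ (<⇒≤ 0<x) x≤y) ,
  (λ x 0<x → positive⁻¹ (x * x) {{pos*pos⇒pos x {{positive 0<x}} x {{positive 0<x}}}})

-- The hierarchy is only used through ε ≤ η² and η ≤ ½.
lemma5p6 : Σ (ℚ → ℚ) λ fη → Σ (ℚ → ℚ) λ fε → Σ (ℚ → ℚ) λ fn →
    Admissible fη × Admissible fε × Admissible fn ×
    ((n : ℕ) → .{{_ : NonZero n}} → (ε η : ℚ) → (G H : Graph n) → (r : ℕ) →
      0ℚ < ε → 0ℚ < η →
      + 1 / n ≤ fn ε → ε ≤ fε η → η ≤ fη (½ - α G) →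
      - ε ≤ α G → α G < ½ →
      ¬ Extremal (+ 2 / 1 * η) G →
      IsFactor r H G → ⟦ r ⟧ ≡ ε * ⟦ n ⟧ →
      ¬ Extremal η (G ⊖ H))
lemma5p6 =
  (λ _ → ½) , (λ η → η * η) , (λ _ → 1ℚ) ,
  const-admissible ½ (positive⁻¹ ½) , square-admissible , const-admissible 1ℚ (positive⁻¹ 1ℚ) ,
  λ n ε η G H r 0<ε 0<η _ ε≤η² η≤½ _ _ ¬2η-extremal factor r≡εn η-extremal →
    ¬2η-extremal (perturbation-extremal G (G ⊖ H) (⊖-factor-perturbation G H r ε factor r≡εn)
                   (<⇒≤ 0<ε) (<⇒≤ 0<η) ε≤η² η≤½ η-extremal)
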